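{- Let $(G,G_\bullet)$ be a filtered group of degree $k$ and let $\Gamma,K\subseteq G$ be subgroups. Then the following are equivalent: (i) for all $x\in G$ and all $i\ge0$, $(Kx\Gamma)\cap(G_ix\Gamma)=(K\cap G_i)x\Gamma$; (ii) for all $x\in G$ and all $i\ge0$, $(Kx\Gamma)\cap(KxG_i)=Kx(\Gamma\cap G_i)$.
   Context: A filtered group of degree $k$ is a group $G$ with a sequence of subgroups $G=G_0=G_1\supseteq G_2\supseteq\cdots$ such that $[G_i,G_j]\subseteq G_{i+j}$ for all $i,j\ge0$ and $G_{k+1}=\{1\}$ (in particular each $G_i$ is normal in $G$). Products such as $Kx\Gamma$ denote sets $\{ax b: a\in K, b\in\Gamma\}$. -}

module Defs where

open import Level using (Level; _⊔_; suc)
open import Data.Nat using (ℕ; zero; _+_)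
open import Data.Product using (_×_; ∃; ∃-syntax; _,_)
open import Function.Bundles using (_⇔_)
open import Relation.Unary using (Pred)
open import Algebra.Bundles using (Group)

module _ {c ℓ : Level} (G : Group c ℓ) where
  open Group G

  record IsSubgroup {p : Level} (H : Pred Carrier p) : Set (c ⊔ ℓ ⊔ p) where
    field
      resp  : ∀ {x y} → x ≈ y → H x → H y
      ε∈    : H ε
      ∙-closed : ∀ {x y} → H x → H y → H (x ∙ y)
      ⁻¹-closed : ∀ {x} → H x → H (x ⁻¹)

  [_,_] : Carrier → Carrier → Carrier
  [ a , b ] = a ⁻¹ ∙ b ⁻¹ ∙ a ∙ b

  record IsFiltration {p : Level} (k : ℕ) (Gᵢ : ℕ → Pred Carrier p)
      : Set (c ⊔ ℓ ⊔ p) where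
    field
      subgroup   : ∀ i → IsSubgroup (Gᵢ i)
      G₀-full    : ∀ x → Gᵢ 0 x
      G₁-full    : ∀ x → Gᵢ 1 x
      decreasing : ∀ i {x} → Gᵢ (ℕ.suc i) x → Gᵢ i x
      commutator : ∀ i j {a b} → Gᵢ i a → Gᵢ j b → Gᵢ (i + j) [ a , b ]
      trivial    : ∀ {x} → Gᵢ (ℕ.suc k) x → x ≈ ε

  _·_·_ : ∀ {p q} → Pred Carrier p → Carrier → Pred Carrier q → Pred Carrier (c ⊔ ℓ ⊔ p ⊔ q)
  (A · x · B) g = ∃[ a ] ∃[ b ] (A a × B b × g ≈ a ∙ x ∙ b)

  _∩_ : ∀ {p q} → Pred Carrier p → Pred Carrier q → Pred Carrier (p ⊔ q)
  (A ∩ B) g = A g × B g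

  _≐_ : ∀ {p q} → Pred Carrier p → Pred Carrier q → Set (c ⊔ p ⊔ q)
  A ≐ B = ∀ g → A g ⇔ B g

{-# OPTIONS --safe #-}
-- Inversion maps K x Γ onto Γ x⁻¹ K, so it exchanges condition (ii) for (K, Γ, x)
-- with condition (i) for (Γ, K, x⁻¹); hence (ii) ⇒ (i) is (i) ⇒ (ii) with K and Γ
-- swapped. For (i) ⇒ (ii), let g ∈ K x Γ with g = a x n, a ∈ K, n ∈ N. Then
-- h = a⁻¹ g = x n lies in K x Γ ∩ N x Γ, so (i) gives h = d x β with d ∈ K ∩ N and
-- β ∈ Γ; moreover β = x⁻¹ d⁻¹ x n ∈ N, whence g = (a d) x β ∈ K x (Γ ∩ N).
module Submission where

open import Defs
open import Level using (Level; _⊔_)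
open import Data.Nat using (ℕ)
open import Data.Product using (_,_)
open import Function.Bundles using (_⇔_; mk⇔; Equivalence)
open import Relation.Unary using (Pred; _⊆_)
open import Algebra.Bundles using (Group)

module _ {c ℓ : Level} (G : Group c ℓ) where
  open Group G
  open import Algebra.Properties.Group G
    using (⁻¹-involutive; ⁻¹-anti-homo-∙; y≈x\\z; \\-leftDividesˡ)
  open import Relation.Binary.Reasoning.Setoid setoid

  private
    variable
      p q r : Level
      A : Pred Carrier p
      B : Pred Carrier q
      N : Pred Carrier r
      g x y : Carrier

  IsNormal : Pred Carrier p → Set (c ⊔ p)
  IsNormal N = ∀ z {y} → N y → N (z ⁻¹ ∙ y ∙ z)

  InverseClosed : Pred Carrier p → Set (c ⊔ p)
  InverseClosed A = ∀ {a} → A a → A (a ⁻¹)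

  filtration-normal : ∀ {k} {Gᵢ : ℕ → Pred Carrier p} →
                      IsFiltration G k Gᵢ → ∀ i → IsNormal (Gᵢ i)
  filtration-normal F i z {y} y∈Gᵢ =
    resp [z,y⁻¹]y≈y^z (∙-closed (commutator 0 i (G₀-full z) (⁻¹-closed y∈Gᵢ)) y∈Gᵢ)
    where
    open IsFiltration F
    open IsSubgroup (subgroup i)
    [z,y⁻¹]y≈y^z : [_,_] G z (y ⁻¹) ∙ y ≈ z ⁻¹ ∙ y ∙ z
    [z,y⁻¹]y≈y^z = begin
      z ⁻¹ ∙ y ⁻¹ ⁻¹ ∙ z ∙ y ⁻¹ ∙ y   ≈⟨ assoc _ _ _ ⟩
      z ⁻¹ ∙ y ⁻¹ ⁻¹ ∙ z ∙ (y ⁻¹ ∙ y) ≈⟨ ∙-congˡ (inverseˡ y) ⟩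
      z ⁻¹ ∙ y ⁻¹ ⁻¹ ∙ z ∙ ε          ≈⟨ identityʳ _ ⟩
      z ⁻¹ ∙ y ⁻¹ ⁻¹ ∙ z              ≈⟨ ∙-congʳ (∙-congˡ (⁻¹-involutive y)) ⟩
      z ⁻¹ ∙ y ∙ z                    ∎

  ⊆⇔≐ : {A : Pred Carrier p} {B : Pred Carrier q} → B ⊆ A → A ⊆ B ⇔ _≐_ G A B
  ⊆⇔≐ {A = A} {B = B} B⊆A = mk⇔ ⊆⇒≐ ≐⇒⊆
    where
    ⊆⇒≐ : A ⊆ B → _≐_ G A B
    ⊆⇒≐ A⊆B g = mk⇔ A⊆B B⊆A
    ≐⇒⊆ : _≐_ G A B → A ⊆ B
    ≐⇒⊆ A≐B {g} = Equivalence.to (A≐B g)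

  ·-∩ˡ-⊆ : ∀ {A : Pred Carrier p} {N : Pred Carrier r} {B : Pred Carrier q} {x} →
           _·_·_ G (_∩_ G A N) x B ⊆ _∩_ G (_·_·_ G A x B) (_·_·_ G N x B)
  ·-∩ˡ-⊆ (a , b , (a∈A , a∈N) , b∈B , g≈axb) =
    (a , b , a∈A , b∈B , g≈axb) , (a , b , a∈N , b∈B , g≈axb)

  ·-∩ʳ-⊆ : ∀ {A : Pred Carrier p} {B : Pred Carrier q} {N : Pred Carrier r} {x} →
           _·_·_ G A x (_∩_ G B N) ⊆ _∩_ G (_·_·_ G A x B) (_·_·_ G A x N)
  ·-∩ʳ-⊆ (a , b , a∈A , (b∈B , b∈N) , g≈axb) =
    (a , b , a∈A , b∈B , g≈axb) , (a , b , a∈A , b∈N , g≈axb)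

  ·-resp : g ≈ y → _·_·_ G A x B g → _·_·_ G A x B y
  ·-resp g≈y (a , b , a∈A , b∈B , g≈axb) = a , b , a∈A , b∈B , trans (sym g≈y) g≈axb

  ·-absorbˡ : (∀ {a a′} → A a → A a′ → A (a ∙ a′)) →
              ∀ {a} → A a → _·_·_ G A x B g → _·_·_ G A x B (a ∙ g)
  ·-absorbˡ {x = x} {g = g} ∙-closed {a} a∈A (a′ , b , a′∈A , b∈B , g≈a′xb) =
    a ∙ a′ , b , ∙-closed a∈A a′∈A , b∈B , (begin
      a ∙ g            ≈⟨ ∙-congˡ g≈a′xb ⟩
      a ∙ (a′ ∙ x ∙ b) ≈⟨ assoc _ _ _ ⟨
      a ∙ (a′ ∙ x) ∙ b ≈⟨ ∙-congʳ (assoc _ _ _) ⟨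
      a ∙ a′ ∙ x ∙ b   ∎)

  ·-normal-shift : IsNormal N → B ε → ∀ {n} → N n → _·_·_ G N x B (x ∙ n)
  ·-normal-shift {x = x} normal ε∈B {n} n∈N =
    x ⁻¹ ⁻¹ ∙ n ∙ x ⁻¹ , ε , normal (x ⁻¹) n∈N , ε∈B , (begin
      x ∙ n                             ≈⟨ ∙-congʳ (⁻¹-involutive x) ⟨
      x ⁻¹ ⁻¹ ∙ n                       ≈⟨ identityʳ _ ⟨
      x ⁻¹ ⁻¹ ∙ n ∙ ε                   ≈⟨ ∙-congˡ (inverseˡ x) ⟨
      x ⁻¹ ⁻¹ ∙ n ∙ (x ⁻¹ ∙ x)          ≈⟨ assoc _ _ _ ⟨
      x ⁻¹ ⁻¹ ∙ n ∙ x ⁻¹ ∙ x            ≈⟨ identityʳ _ ⟨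
      x ⁻¹ ⁻¹ ∙ n ∙ x ⁻¹ ∙ x ∙ ε        ∎)

  ·-inverse : InverseClosed A → InverseClosed B → x ⁻¹ ≈ y →
              _·_·_ G A x B g → _·_·_ G B y A (g ⁻¹)
  ·-inverse {x = x} {y} {g = g} A⁻¹ B⁻¹ x⁻¹≈y (a , b , a∈A , b∈B , g≈axb) =
    b ⁻¹ , a ⁻¹ , B⁻¹ b∈B , A⁻¹ a∈A , (begin
      g ⁻¹                  ≈⟨ ⁻¹-cong g≈axb ⟩
      (a ∙ x ∙ b) ⁻¹        ≈⟨ ⁻¹-anti-homo-∙ _ _ ⟩
      b ⁻¹ ∙ (a ∙ x) ⁻¹     ≈⟨ ∙-congˡ (⁻¹-anti-homo-∙ _ _) ⟩
      b ⁻¹ ∙ (x ⁻¹ ∙ a ⁻¹)  ≈⟨ assoc _ _ _ ⟨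
      b ⁻¹ ∙ x ⁻¹ ∙ a ⁻¹    ≈⟨ ∙-congʳ (∙-congˡ x⁻¹≈y) ⟩
      b ⁻¹ ∙ y ∙ a ⁻¹       ∎)

  ⁻¹-swap : x ⁻¹ ≈ y → y ⁻¹ ≈ x
  ⁻¹-swap {x} x⁻¹≈y = trans (⁻¹-cong (sym x⁻¹≈y)) (⁻¹-involutive x)

  ·-inverse⁻ : InverseClosed A → InverseClosed B → x ⁻¹ ≈ y →
               _·_·_ G A x B (g ⁻¹) → _·_·_ G B y A g
  ·-inverse⁻ {g = g} A⁻¹ B⁻¹ x⁻¹≈y m = ·-resp (⁻¹-involutive g) (·-inverse A⁻¹ B⁻¹ x⁻¹≈y m)

  -- The non-trivial inclusions in (i) and (ii) at a point x; the reverse ones are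
  -- ·-∩ˡ-⊆ and ·-∩ʳ-⊆.
  Factorsˡ : Pred Carrier p → Pred Carrier r → Pred Carrier q → Carrier → Set _
  Factorsˡ K N Γ x = _∩_ G (_·_·_ G K x Γ) (_·_·_ G N x Γ) ⊆ _·_·_ G (_∩_ G K N) x Γ

  Factorsʳ : Pred Carrier p → Pred Carrier r → Pred Carrier q → Carrier → Set _
  Factorsʳ K N Γ x = _∩_ G (_·_·_ G K x Γ) (_·_·_ G K x N) ⊆ _·_·_ G K x (_∩_ G Γ N)

  factorsˡ⇔factorsʳ-⁻¹ : ∀ {K : Pred Carrier p} {Γ : Pred Carrier q} →
    InverseClosed K → InverseClosed Γ → InverseClosed N → x ⁻¹ ≈ y →
    Factorsˡ Γ N K y ⇔ Factorsʳ K N Γ x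
  factorsˡ⇔factorsʳ-⁻¹ {N = N} {x = x} {y} {Γ = Γ} K⁻¹ Γ⁻¹ N⁻¹ x⁻¹≈y = mk⇔
    (λ F {_} (g∈KxΓ , g∈KxN) → ·-inverse⁻ ∩⁻¹ K⁻¹ (⁻¹-swap x⁻¹≈y)
      (F (·-inverse K⁻¹ Γ⁻¹ x⁻¹≈y g∈KxΓ , ·-inverse K⁻¹ N⁻¹ x⁻¹≈y g∈KxN)))
    (λ F {_} (g∈ΓyK , g∈NyK) → ·-inverse⁻ K⁻¹ ∩⁻¹ x⁻¹≈y
      (F (·-inverse Γ⁻¹ K⁻¹ y⁻¹≈x g∈ΓyK , ·-inverse N⁻¹ K⁻¹ y⁻¹≈x g∈NyK)))
    where
    y⁻¹≈x : y ⁻¹ ≈ x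
    y⁻¹≈x = ⁻¹-swap x⁻¹≈y
    ∩⁻¹ : InverseClosed (_∩_ G Γ N)
    ∩⁻¹ (b∈Γ , b∈N) = Γ⁻¹ b∈Γ , N⁻¹ b∈N

  factorsˡ⇒factorsʳ : ∀ {K : Pred Carrier p} {Γ : Pred Carrier q} →
    IsSubgroup G K → IsSubgroup G Γ → IsSubgroup G N → IsNormal N →
    Factorsˡ K N Γ x → Factorsʳ K N Γ x
  factorsˡ⇒factorsʳ {N = N} {x} {K} {Γ} sK sΓ sN normal F {g}
    (g∈KxΓ , (a , n , a∈K , n∈N , g≈axn)) =
    ·-resp (\\-leftDividesˡ a g) (·-absorbˡ K.∙-closed a∈K (lift (F (h∈KxΓ , h∈NxΓ))))
    where
    module K = IsSubgroup sK
    module Γ = IsSubgroup sΓ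
    module N = IsSubgroup sN

    h≈xn : a ⁻¹ ∙ g ≈ x ∙ n
    h≈xn = sym (y≈x\\z a (x ∙ n) g (sym (trans g≈axn (assoc a x n))))

    h∈KxΓ : _·_·_ G K x Γ (a ⁻¹ ∙ g)
    h∈KxΓ = ·-absorbˡ K.∙-closed (K.⁻¹-closed a∈K) g∈KxΓ

    h∈NxΓ : _·_·_ G N x Γ (a ⁻¹ ∙ g)
    h∈NxΓ = ·-resp (sym h≈xn) (·-normal-shift normal Γ.ε∈ n∈N)

    lift : _·_·_ G (_∩_ G K N) x Γ (a ⁻¹ ∙ g) → _·_·_ G K x (_∩_ G Γ N) (a ⁻¹ ∙ g)
    lift (d , β , (d∈K , d∈N) , β∈Γ , h≈dxβ) = d , β , d∈K , (β∈Γ , β∈N) , h≈dxβ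
      where
      β≈ : β ≈ x ⁻¹ ∙ d ⁻¹ ∙ x ∙ n
      β≈ = begin
        β                     ≈⟨ y≈x\\z (d ∙ x) β (x ∙ n) (trans (sym h≈dxβ) h≈xn) ⟩
        (d ∙ x) ⁻¹ ∙ (x ∙ n)  ≈⟨ ∙-congʳ (⁻¹-anti-homo-∙ d x) ⟩
        x ⁻¹ ∙ d ⁻¹ ∙ (x ∙ n) ≈⟨ assoc _ _ _ ⟨
        x ⁻¹ ∙ d ⁻¹ ∙ x ∙ n   ∎
      β∈N : N β
      β∈N = N.resp (sym β≈) (N.∙-closed (normal x (N.⁻¹-closed d∈N)) n∈N)

  factorsʳ⇒factorsˡ : ∀ {K : Pred Carrier p} {Γ : Pred Carrier q} →
    IsSubgroup G K → IsSubgroup G Γ → IsSubgroup G N → IsNormal N →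
    (∀ x → Factorsʳ K N Γ x) → Factorsˡ K N Γ x
  factorsʳ⇒factorsˡ {x = x} sK sΓ sN normal F =
    Equivalence.from (factorsˡ⇔factorsʳ-⁻¹ Γ⁻¹ K⁻¹ N⁻¹ (⁻¹-involutive x))
      (factorsˡ⇒factorsʳ sΓ sK sN normal
        (Equivalence.from (factorsˡ⇔factorsʳ-⁻¹ K⁻¹ Γ⁻¹ N⁻¹ refl) (F x)))
    where
    K⁻¹ = IsSubgroup.⁻¹-closed sK
    Γ⁻¹ = IsSubgroup.⁻¹-closed sΓ
    N⁻¹ = IsSubgroup.⁻¹-closed sN

lemma7p4 : {c ℓ p q r : Level} (G : Group c ℓ) (k : ℕ)
    (Gᵢ : ℕ → Pred (Group.Carrier G) p) → IsFiltration G k Gᵢ →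
    (Γ : Pred (Group.Carrier G) q) (K : Pred (Group.Carrier G) r) →
    IsSubgroup G Γ → IsSubgroup G K →
    ((∀ (x : Group.Carrier G) (i : ℕ) →
        _≐_ G (_∩_ G (_·_·_ G K x Γ) (_·_·_ G (Gᵢ i) x Γ)) (_·_·_ G (_∩_ G K (Gᵢ i)) x Γ))
     ⇔
     (∀ (x : Group.Carrier G) (i : ℕ) →
        _≐_ G (_∩_ G (_·_·_ G K x Γ) (_·_·_ G K x (Gᵢ i))) (_·_·_ G K x (_∩_ G Γ (Gᵢ i)))))
lemma7p4 G k Gᵢ F Γ K sΓ sK = mk⇔
  (λ H x i → to (⊆⇔≐ G (·-∩ʳ-⊆ G))
     (factorsˡ⇒factorsʳ G sK sΓ (subgroup i) (normal i) (from (⊆⇔≐ G (·-∩ˡ-⊆ G)) (H x i))))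
  (λ H x i → to (⊆⇔≐ G (·-∩ˡ-⊆ G))
     (factorsʳ⇒factorsˡ G sK sΓ (subgroup i) (normal i) (λ y → from (⊆⇔≐ G (·-∩ʳ-⊆ G)) (H y i))))
  where
  open Equivalence
  open IsFiltration F using (subgroup)
  normal : ∀ i → IsNormal G (Gᵢ i)
  normal = filtration-normal G F
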